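{- For every $n\ge 6$, the diameter of the 1-skeleton of $\mathrm{PYR}(n)$ equals $2$.
   Context: Let $K_n$ be the complete undirected graph on vertex set $\{1,\dots,n\}$ with edge set $E$. A Hamiltonian tour $\langle 1,i_1,\dots,i_r,n,j_1,\dots,j_{n-r-2}\rangle$ is called pyramidal if $i_1<\dots<i_r$ and $j_1>\dots>j_{n-r-2}$ (tours are undirected). The characteristic vector $x^{v}\in\mathbb{R}^{E}$ of a tour $x$ has $x^{v}_e=1$ iff $e$ is an edge of $x$. $\mathrm{PYR}(n)=\mathrm{conv}\{x^{v} : x$ pyramidal tour in $K_n\}$. The 1-skeleton of a polytope is the graph whose vertices are the vertices of the polytope and whose edges are the one-dimensional faces of the polytope; its diameter is the maximum graph distance between two of its vertices. -}

module Defs where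

open import Data.Nat using (ℕ; zero; suc) renaming (_<_ to _<ℕ_; _<ᵇ_ to _<ᵇℕ_)
open import Data.Fin using (Fin; toℕ; _<_)
open import Data.Fin.Properties using (_≟_)
open import Data.Bool using (Bool; true; false; if_then_else_; _∧_; _∨_)
open import Data.List using (List; []; _∷_; _++_; foldr; map)
open import Data.List.Relation.Unary.Linked using (Linked)
open import Data.List.Relation.Binary.Permutation.Propositional using (_↭_)
open import Data.Fin.Base using () renaming (_≤_ to _≤F_)
open import Data.List using (allFin)
open import Data.Product using (Σ; _×_; _,_)
open import Data.Sum using (_⊎_)
open import Data.Rational using (ℚ; 0ℚ; 1ℚ; _+_; _*_; _≤_)
open import Relation.Nullary using (¬_; does)
open import Relation.Binary.PropositionalEquality using (_≡_)

-- Vertices of K_n are Fin n; paper's vertex k is (k-1) here, so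
-- vertex 1 is the element with toℕ ≡ 0 and vertex n the one with suc (toℕ) ≡ n.

-- A pyramidal tour ⟨1, i_1, …, i_r, n, j_1, …, j_{n-r-2}⟩ :
-- the cyclic sequence  first ∷ asc ++ last ∷ desc  lists every vertex exactly once,
-- asc is strictly increasing, desc strictly decreasing.
record PyrTour (n : ℕ) : Set where
  field
    first  : Fin n
    last   : Fin n
    first-is-1 : toℕ first ≡ 0
    last-is-n  : suc (toℕ last) ≡ n
    asc    : List (Fin n)
    desc   : List (Fin n)
    asc-inc  : Linked _<_ asc
    desc-dec : Linked (λ a b → b < a) desc
    is-perm  : (first ∷ asc ++ last ∷ desc) ↭ allFin n

  cycle : List (Fin n)
  cycle = first ∷ asc ++ last ∷ desc

open PyrTour public

consec : ∀ {n} → List (Fin n) → List (Fin n × Fin n)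
consec (x ∷ y ∷ xs) = (x , y) ∷ consec (y ∷ xs)
consec _ = []

lastOf : ∀ {n} → Fin n → List (Fin n) → Fin n
lastOf x [] = x
lastOf x (y ∷ ys) = lastOf y ys

cycEdges : ∀ {n} → List (Fin n) → List (Fin n × Fin n)
cycEdges [] = []
cycEdges (x ∷ xs) = (lastOf x xs , x) ∷ consec (x ∷ xs)

hasEdge : ∀ {n} → List (Fin n × Fin n) → Fin n → Fin n → Bool
hasEdge [] i j = false
hasEdge ((a , b) ∷ es) i j =
  ((does (a ≟ i) ∧ does (b ≟ j)) ∨ (does (a ≟ j) ∧ does (b ≟ i))) ∨ hasEdge es i j

-- characteristic vector x^v ∈ ℚ^E (E = pairs i<j), as a function on pairs
χ : ∀ {n} → PyrTour n → Fin n → Fin n → ℚ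
χ T i j = if hasEdge (cycEdges (cycle T)) i j then 1ℚ else 0ℚ

sumℚ : List ℚ → ℚ
sumℚ = foldr _+_ 0ℚ

dot : ∀ {n} → (Fin n → Fin n → ℚ) → (Fin n → Fin n → ℚ) → ℚ
dot {n} c x = sumℚ (map (λ i → sumℚ (map (λ j →
  if toℕ i <ᵇℕ toℕ j then c i j * x i j else 0ℚ) (allFin n))) (allFin n))

-- two tours give the same vertex of PYR(n): equal characteristic vectors on E
SameVertex : ∀ {n} → PyrTour n → PyrTour n → Set
SameVertex T U = ∀ i j → toℕ i <ℕ toℕ j → χ T i j ≡ χ U i j

-- χT, χU span an edge (1-dim face) of PYR(n): they are distinct and
-- there is a valid inequality c·z ≤ c·χT for PYR(n) whose face (the set of
-- vertices attaining equality) consists exactly of χT and χU.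
Adjacent : ∀ {n} → PyrTour n → PyrTour n → Set
Adjacent {n} T U =
  ¬ SameVertex T U ×
  Σ (Fin n → Fin n → ℚ) λ c →
    dot c (χ T) ≡ dot c (χ U) ×
    (∀ (W : PyrTour n) → dot c (χ W) ≤ dot c (χ T)) ×
    (∀ (W : PyrTour n) → dot c (χ W) ≡ dot c (χ T) → SameVertex W T ⊎ SameVertex W U)

Dist≤2 : ∀ {n} → PyrTour n → PyrTour n → Set
Dist≤2 {n} T U =
  SameVertex T U ⊎ Adjacent T U ⊎ Σ (PyrTour n) (λ W → Adjacent T W × Adjacent W U)

Diameter≡2 : ℕ → Set
Diameter≡2 n =
  (∀ (T U : PyrTour n) → Dist≤2 T U) ×
  Σ (PyrTour n) λ T → Σ (PyrTour n) λ U → ¬ SameVertex T U × ¬ Adjacent T U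

{-# OPTIONS --safe #-}
module Submission where

-- Write the vertices as 0, …, n-1.  A pyramidal tour is determined by its side function s,
-- where s k says whether the inner vertex k is visited on the ascending path from 0 to n-1;
-- its edges join consecutive vertices of the ascending chain {0, n-1} ∪ {k | s k} or of the
-- descending chain {0, n-1} ∪ {k | not (s k)}.
--
-- Upper bound: every tour X is equal or adjacent to the path tour H = ⟨0, 1, …, n-1⟩.  The
-- cost -1 on the edges outside X ∪ H is maximised exactly by the tours using only edges of
-- X ∪ H, and walking along the inner vertices one shows that such a tour has the side
-- function of H or of X (up to exchanging the chains).
--
-- Lower bound: let T, U, V, V′ have sides (t,t,f), (t,f,t), (f,f,t), (f,t,f) on the vertices
-- 1, 2, 3 and all further inner vertices ascending.  Then χ T + χ U = χ V + χ V′, so a linear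
-- functional maximised at T and U is maximised at V too, and T, U are not adjacent.

open import Algebra.Bundles using (CommutativeMonoid)
open import Data.Bool using (Bool; true; false; not; _∧_; _∨_; if_then_else_; T)
open import Data.Bool.Properties
  using (∨-comm; ∨-zeroʳ; ∧-zeroʳ; not-involutive; ¬-not) renaming (_≟_ to _≟ᵇ_)
open import Data.Empty using (⊥; ⊥-elim)
open import Data.Fin as Fin using (Fin; toℕ; fromℕ<; fromℕ; inject₁; lower₁; #_)
open import Data.Fin.Properties
  using (all?; toℕ-injective; toℕ<n; toℕ-fromℕ<; toℕ-fromℕ; toℕ-inject₁; inject₁-lower₁)
  renaming (_≟_ to _≟ᶠ_)
open import Data.Nat using (ℕ; zero; suc; _+_; _∸_; _≤_; _<_; z≤n; s≤s; z<s; _<ᵇ_; _<?_; _≤?_)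
open import Data.Nat.Properties
open import Data.List using (List; []; _∷_; _++_; map; filter; reverse; tabulate; allFin)
open import Data.List.Properties using (++-assoc; unfold-reverse; partition-defn; map-cong)
open import Data.List.Membership.Propositional using (_∈_)
open import Data.List.Membership.Propositional.Properties
  using (∈-++⁺ˡ; ∈-++⁺ʳ; ∈-++⁻; ∈-map⁺; ∈-map⁻; ∈-allFin; ∈-tabulate⁺; ∈-filter⁺; ∈-filter⁻)
open import Data.List.Membership.DecPropositional _≟_ using (_∈?_)
open import Data.List.Relation.Binary.Permutation.Propositional
  using (_↭_; prep; ↭-sym; ↭-trans; ↭-reflexive; ↭⇒↭ₛ; ↭ₛ⇒↭; module PermutationReasoning)
open import Data.List.Relation.Binary.Permutation.Propositional.Properties
  using (∷↭∷ʳ; ∈-resp-↭; shift; ++⁺ˡ; ↭-reverse; filter-↭)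
import Data.List.Relation.Binary.Permutation.Setoid.Properties as PermutationSetoid
open import Data.List.Relation.Unary.All as All using (All; []; _∷_)
open import Data.List.Relation.Unary.AllPairs using (AllPairs; []; _∷_)
import Data.List.Relation.Unary.AllPairs.Properties as AllPairs
open import Data.List.Relation.Unary.Any using (here; there)
import Data.List.Relation.Unary.Any.Properties as Any
open import Data.List.Relation.Unary.Linked using (Linked; []; [-]; _∷_)
open import Data.List.Relation.Unary.Linked.Properties using (Linked⇒All; AllPairs⇒Linked)
open import Data.List.Relation.Unary.Unique.Propositional using (Unique)
open import Data.List.Relation.Unary.Unique.Propositional.Properties using (allFin⁺)
open import Data.Product using (Σ; _×_; _,_; proj₁; proj₂)
open import Data.Rational as ℚ using (ℚ; 0ℚ; 1ℚ)
import Data.Rational.Properties as ℚ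
open import Data.Sum using (_⊎_; inj₁; inj₂; [_,_]′; map₁; map₂)
import Data.Sum
open import Data.Unit using (tt)
open import Function using (_∘_; id)
open import Relation.Binary using (Rel; Transitive; Asymmetric; tri<; tri≈; tri>)
open import Relation.Binary.PropositionalEquality
open import Relation.Binary.PropositionalEquality.Properties using (setoid)
open import Relation.Nullary using (Dec; yes; no; does; ¬_)
open import Relation.Nullary.Decidable using (_→-dec_; toWitness; dec-true; dec-false)
open import Relation.Unary using (Pred; Decidable)
open import Relation.Unary.Properties using (∁?)

open import Algebra.Properties.CommutativeSemigroup
  (CommutativeMonoid.commutativeSemigroup ℚ.+-0-commutativeMonoid) using (interchange)

open import Defs

true≢false : true ≢ false
true≢false ()

does-true⁻ : ∀ {A : Set} (a? : Dec A) → does a? ≡ true → A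
does-true⁻ (yes a) _ = a

∨-true⁻ : ∀ a {b} → a ∨ b ≡ true → a ≡ true ⊎ b ≡ true
∨-true⁻ true  _ = inj₁ refl
∨-true⁻ false e = inj₂ e

∨-trueʳ : ∀ a {b} → b ≡ true → a ∨ b ≡ true
∨-trueʳ true  _ = refl
∨-trueʳ false e = e

∨-trueˡ : ∀ {a} b → a ≡ true → a ∨ b ≡ true
∨-trueˡ b refl = refl

∧-true⁻ : ∀ a {b} → a ∧ b ≡ true → a ≡ true × b ≡ true
∧-true⁻ true e = refl , e

bool-ext : ∀ {a b : Bool} → (a ≡ true → b ≡ true) → (b ≡ true → a ≡ true) → a ≡ b
bool-ext {true}  {true}  _ _ = refl
bool-ext {true}  {false} f _ = sym (f refl)
bool-ext {false} {true}  _ g = g refl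
bool-ext {false} {false} _ _ = refl

_==_ : Bool → Bool → Bool
true  == b = b
false == b = not b

==-true⁻ : ∀ c b → c == b ≡ true → b ≡ c
==-true⁻ true  true  _ = refl
==-true⁻ false false _ = refl

==-refl : ∀ c → c == c ≡ true
==-refl true  = refl
==-refl false = refl

==-not : ∀ c → not c == c ≡ false
==-not true  = refl
==-not false = refl

==-either : ∀ c b → c == b ≡ true ⊎ c == not b ≡ true
==-either true  true  = inj₁ refl
==-either true  false = inj₂ refl
==-either false true  = inj₂ refl
==-either false false = inj₁ refl

not-==-false⁻ : ∀ c b → not c == b ≡ false → b ≡ c
not-==-false⁻ true  true  _ = refl
not-==-false⁻ false false _ = refl

not-== : ∀ c b → c == not b ≡ not c == b
not-== true  b = refl
not-== false b = not-involutive b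

NoneBetween : (ℕ → Bool) → ℕ → ℕ → Set
NoneBetween p i j = ∀ k → i < k → k < j → p k ≡ false

noneBetween-suc : ∀ p i → NoneBetween p i (suc i)
noneBetween-suc p i k i<k k<1+i = ⊥-elim (≤⇒≯ (≤-pred k<1+i) i<k)

lastBefore : (p : ℕ → Bool) → p 0 ≡ true → ∀ k → 0 < k → Σ ℕ λ i → i < k × p i ≡ true × NoneBetween p i k
lastBefore p p0 (suc zero)    _ = 0 , z<s , p0 , noneBetween-suc p 0
lastBefore p p0 (suc (suc k)) _ with p (suc k) in pk | lastBefore p p0 (suc k) z<s
... | true  | _ = suc k , ≤-refl , pk , noneBetween-suc p (suc k)
... | false | i , i<k , pi , none = i , m<n⇒m<1+n i<k , pi , none′
  where
  none′ : NoneBetween p i (suc (suc k))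
  none′ l i<l l<k+2 with m<1+n⇒m<n∨m≡n l<k+2
  ... | inj₁ l<k+1 = none l i<l l<k+1
  ... | inj₂ refl  = pk

firstFrom : (p : ℕ → Bool) → ∀ a l → p (a + l) ≡ true →
            Σ ℕ λ u → a ≤ u × u ≤ a + l × p u ≡ true × (∀ k → a ≤ k → k < u → p k ≡ false)
firstFrom p a l pal with p a in pa
... | true  = a , ≤-refl , m≤m+n a l , pa , λ k a≤k k<a → ⊥-elim (<⇒≱ k<a a≤k)
firstFrom p a zero    pa+0 | false =
  ⊥-elim (true≢false (trans (sym pa+0) (subst (λ x → p x ≡ false) (sym (+-identityʳ a)) pa)))
firstFrom p a (suc l) pal  | false with firstFrom p (suc a) l (subst (λ x → p x ≡ true) (+-suc a l) pal)
... | u , a<u , u≤ , pu , none = u , <⇒≤ a<u , subst (u ≤_) (sym (+-suc a l)) u≤ , pu , none′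
  where
  none′ : ∀ k → a ≤ k → k < u → p k ≡ false
  none′ k a≤k k<u with m≤n⇒m<n∨m≡n a≤k
  ... | inj₁ a<k = none k a<k k<u
  ... | inj₂ refl = pa

firstAfter : (p : ℕ → Bool) → ∀ i j → i < j → p j ≡ true →
             Σ ℕ λ u → i < u × u ≤ j × p u ≡ true × NoneBetween p i u
firstAfter p i j i<j pj
  with firstFrom p (suc i) (j ∸ suc i) (subst (λ x → p x ≡ true) (sym (m+[n∸m]≡n i<j)) pj)
... | u , i<u , u≤ , pu , none = u , i<u , subst (u ≤_) (m+[n∸m]≡n i<j) u≤ , pu , none

noneFrom : (ℕ → Bool) → ℕ → ℕ → Bool
noneFrom p a zero    = true
noneFrom p a (suc l) = not (p a) ∧ noneFrom p (suc a) l

module _ (p : ℕ → Bool) where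

  noneFrom-sound : ∀ a l → noneFrom p a l ≡ true → ∀ k → a ≤ k → k < a + l → p k ≡ false
  noneFrom-sound a zero    _ k a≤k k<a+0 =
    ⊥-elim (<⇒≱ k<a+0 (subst (_≤ k) (sym (+-identityʳ a)) a≤k))
  noneFrom-sound a (suc l) e k a≤k k<a+l with p a in pa | m≤n⇒m<n∨m≡n a≤k
  ... | false | inj₂ refl = pa
  ... | false | inj₁ a<k  = noneFrom-sound (suc a) l e k a<k (subst (k <_) (+-suc a l) k<a+l)

  noneFrom-complete : ∀ a l → (∀ k → a ≤ k → k < a + l → p k ≡ false) → noneFrom p a l ≡ true
  noneFrom-complete a zero    _ = refl
  noneFrom-complete a (suc l) h rewrite h a ≤-refl (m<m+n a z<s) =
    noneFrom-complete (suc a) l λ k a<k k<a+l → h k (<⇒≤ a<k) (subst (k <_) (sym (+-suc a l)) k<a+l)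

noneFrom-cong : ∀ {p q} a l → (∀ k → a ≤ k → k < a + l → p k ≡ q k) → noneFrom p a l ≡ noneFrom q a l
noneFrom-cong a zero    _ = refl
noneFrom-cong a (suc l) h = cong₂ (λ x y → not x ∧ y) (h a ≤-refl (m<m+n a z<s))
  (noneFrom-cong (suc a) l λ k a<k k<a+l → h k (<⇒≤ a<k) (subst (k <_) (sym (+-suc a l)) k<a+l))

noneFrom-extend : ∀ p a l l′ → (∀ k → a + l ≤ k → k < a + l + l′ → p k ≡ false) →
                  noneFrom p a (l + l′) ≡ noneFrom p a l
noneFrom-extend p a zero    l′ off = noneFrom-complete p a l′ λ k a≤k k<a+l′ →
  off k (subst (_≤ k) (sym (+-identityʳ a)) a≤k) (subst (λ x → k < x + l′) (sym (+-identityʳ a)) k<a+l′)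
noneFrom-extend p a (suc l) l′ off = cong (not (p a) ∧_) (noneFrom-extend p (suc a) l l′ λ k a+l≤k k<a+l+l′ →
  off k (subst (_≤ k) (sym (+-suc a l)) a+l≤k) (subst (λ x → k < x + l′) (sym (+-suc a l)) k<a+l+l′))

-- The chain c = true is the ascending one; the end points 0 and n-1 lie on both chains.
module _ (n : ℕ) where

  onChain : (ℕ → Bool) → Bool → ℕ → Bool
  onChain s c k = does (k ≟ 0) ∨ does (suc k ≟ n) ∨ (c == s k)

  chainEdge : (ℕ → Bool) → Bool → ℕ → ℕ → Bool
  chainEdge s c i j = onChain s c i ∧ onChain s c j ∧ noneFrom (onChain s c) (suc i) (j ∸ suc i)

  pyrEdge : (ℕ → Bool) → ℕ → ℕ → Bool
  pyrEdge s i j = chainEdge s true i j ∨ chainEdge s false i j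

  Inner : ℕ → Set
  Inner k = 1 ≤ k × suc k < n

  AgreeInside : (ℕ → Bool) → (ℕ → Bool) → Set
  AgreeInside s s′ = ∀ k → Inner k → s k ≡ s′ k

  onChain-last : ∀ s c k → suc k ≡ n → onChain s c k ≡ true
  onChain-last s c zero    _ = refl
  onChain-last s c (suc k) e rewrite dec-true (suc (suc k) ≟ n) e = refl

  onChain-inner : ∀ s c k → Inner k → onChain s c k ≡ c == s k
  onChain-inner s c (suc k) (_ , k<n) rewrite dec-false (suc (suc k) ≟ n) (<⇒≢ k<n) = refl

  onChain-side : ∀ s c k {b} → Inner k → s k ≡ b → onChain s c k ≡ c == b
  onChain-side s c k inner refl = onChain-inner s c k inner

  onChain-cong : ∀ {s s′} c k → k < n → AgreeInside s s′ → onChain s c k ≡ onChain s′ c k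
  onChain-cong c zero    _   _ = refl
  onChain-cong {s} {s′} c (suc k) k<n h with m≤n⇒m<n∨m≡n k<n
  ... | inj₂ last = trans (onChain-last s c (suc k) last) (sym (onChain-last s′ c (suc k) last))
  ... | inj₁ k<n-1 =
    trans (onChain-side s c (suc k) inner (h (suc k) inner)) (sym (onChain-inner s′ c (suc k) inner))
    where
    inner : Inner (suc k)
    inner = s≤s z≤n , k<n-1

  onChain-not : ∀ s c k → onChain (not ∘ s) c k ≡ onChain s (not c) k
  onChain-not s c k = cong (λ b → does (k ≟ 0) ∨ does (suc k ≟ n) ∨ b) (not-== c (s k))

  onChain⁻ : ∀ s c k → onChain s c k ≡ true → k ≡ 0 ⊎ suc k ≡ n ⊎ s k ≡ c
  onChain⁻ s c k e with ∨-true⁻ (does (k ≟ 0)) e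
  ... | inj₁ e′ = inj₁ (does-true⁻ (k ≟ 0) e′)
  ... | inj₂ e′ =
    inj₂ (Data.Sum.map (does-true⁻ (suc k ≟ n)) (==-true⁻ c (s k)) (∨-true⁻ (does (suc k ≟ n)) e′))

  chainEdge-intro : ∀ s c i j → i < j → onChain s c i ≡ true → onChain s c j ≡ true →
                    NoneBetween (onChain s c) i j → chainEdge s c i j ≡ true
  chainEdge-intro s c i j i<j ei ej none rewrite ei | ej =
    noneFrom-complete (onChain s c) (suc i) (j ∸ suc i)
      λ k i<k k<j → none k i<k (subst (k <_) (m+[n∸m]≡n i<j) k<j)

  chainEdge-elim : ∀ s c i j → i < j → chainEdge s c i j ≡ true →
                   onChain s c i ≡ true × onChain s c j ≡ true × NoneBetween (onChain s c) i j
  chainEdge-elim s c i j i<j e with ∧-true⁻ (onChain s c i) e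
  ... | ei , e′ with ∧-true⁻ (onChain s c j) e′
  ... | ej , none = ei , ej , λ k i<k k<j →
    noneFrom-sound (onChain s c) (suc i) (j ∸ suc i) none k i<k (subst (k <_) (sym (m+[n∸m]≡n i<j)) k<j)

  chainEdge-blocked : ∀ s c i j k → i < k → k < j → onChain s c k ≡ true → chainEdge s c i j ≡ false
  chainEdge-blocked s c i j k i<k k<j ek with chainEdge s c i j in e
  ... | false = refl
  ... | true with chainEdge-elim s c i j (<-trans i<k k<j) e
  ...   | _ , _ , none = ⊥-elim (true≢false (trans (sym ek) (none k i<k k<j)))

  chainEdge-offˡ : ∀ s c i j → onChain s c i ≡ false → chainEdge s c i j ≡ false
  chainEdge-offˡ s c i j off rewrite off = refl

  chainEdge-offʳ : ∀ s c i j → onChain s c j ≡ false → chainEdge s c i j ≡ false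
  chainEdge-offʳ s c i j off rewrite off = ∧-zeroʳ (onChain s c i)

  pyrEdge-intro : ∀ s c i j → chainEdge s c i j ≡ true → pyrEdge s i j ≡ true
  pyrEdge-intro s true  i j e rewrite e = refl
  pyrEdge-intro s false i j e = ∨-trueʳ (chainEdge s true i j) e

  pyrEdge-elim : ∀ s i j → pyrEdge s i j ≡ true → Σ Bool λ c → chainEdge s c i j ≡ true
  pyrEdge-elim s i j e with ∨-true⁻ (chainEdge s true i j) e
  ... | inj₁ e′ = true , e′
  ... | inj₂ e′ = false , e′

  chainEdge-cong : ∀ {s s′} c i j → i < j → j < n → AgreeInside s s′ → chainEdge s c i j ≡ chainEdge s′ c i j
  chainEdge-cong c i j i<j j<n h =
    cong₂ _∧_ (onChain-cong c i (<-trans i<j j<n) h) (cong₂ _∧_ (onChain-cong c j j<n h)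
      (noneFrom-cong (suc i) (j ∸ suc i) λ k _ k<j →
         onChain-cong c k (<-trans (subst (k <_) (m+[n∸m]≡n i<j) k<j) j<n) h))

  pyrEdge-cong : ∀ {s s′} i j → i < j → j < n → AgreeInside s s′ → pyrEdge s i j ≡ pyrEdge s′ i j
  pyrEdge-cong i j i<j j<n h =
    cong₂ _∨_ (chainEdge-cong true i j i<j j<n h) (chainEdge-cong false i j i<j j<n h)

  chainEdge-not : ∀ s c i j → chainEdge (not ∘ s) c i j ≡ chainEdge s (not c) i j
  chainEdge-not s c i j = cong₂ _∧_ (onChain-not s c i)
    (cong₂ _∧_ (onChain-not s c j) (noneFrom-cong (suc i) (j ∸ suc i) λ k _ _ → onChain-not s c k))

  -- Exchanging the two chains only reverses the orientation of the tour.
  pyrEdge-not : ∀ s i j → pyrEdge (not ∘ s) i j ≡ pyrEdge s i j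
  pyrEdge-not s i j rewrite chainEdge-not s true i j | chainEdge-not s false i j =
    ∨-comm (chainEdge s false i j) (chainEdge s true i j)

-- Tours with all their edges in T ∪ H, for the path tour H

PathEdge : ℕ → ℕ → ℕ → Set
PathEdge n i j = j ≡ suc i ⊎ (i ≡ 0 × suc j ≡ n)

EdgesWithin : ℕ → (ℕ → Bool) → (ℕ → Bool) → Set
EdgesWithin n sV sT =
  ∀ i j → i < j → j < n → pyrEdge n sV i j ≡ true → pyrEdge n sT i j ≡ true ⊎ PathEdge n i j

ConstantInside : ℕ → (ℕ → Bool) → Set
ConstantInside n s = Σ Bool λ b → AgreeInside n s (λ _ → b)

-- V and T agree on 1, 2, … in turn: at a first disagreement k, with d the common side of
-- k-1, V has an edge jumping over k-1 or k that T does not have, and that is no edge of the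
-- path tour either unless it is {0, n-1}, which leaves V with all inner vertices on side d.
module Agreement (N : ℕ) (sV sT : ℕ → Bool) (within : EdgesWithin (suc N) sV sT) where

  private
    n : ℕ
    n = suc N

  AgreeBelow : ℕ → Set
  AgreeBelow K = ∀ m → 1 ≤ m → m < K → sV m ≡ sT m

  module _ (k′ : ℕ) (1≤k′ : 1 ≤ k′) (k<n-1 : suc (suc k′) < n) (agree : AgreeBelow (suc k′)) where
    private
      k : ℕ
      k = suc k′
      d : Bool
      d = sT k′
      inner-k′ : Inner n k′
      inner-k′ = 1≤k′ , <-trans ≤-refl k<n-1
      inner-k : Inner n k
      inner-k = s≤s z≤n , k<n-1

    ¬V-switches-alone : sT k ≡ d → sV k ≡ not d → ⊥
    ¬V-switches-alone Tk Vk with lastBefore (onChain n sV (not d)) refl k z<s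
    ... | p , p<k , on-p , none = T-lacks (within p k p<k (<-trans ≤-refl k<n-1) V-has)
      where
      off-k′ : onChain n sV (not d) k′ ≡ false
      off-k′ = trans (onChain-side n sV (not d) k′ inner-k′ (agree k′ 1≤k′ ≤-refl)) (==-not d)
      p<k′ : p < k′
      p<k′ = ≤∧≢⇒< (≤-pred p<k) λ { refl → true≢false (trans (sym on-p) off-k′) }
      V-has : pyrEdge n sV p k ≡ true
      V-has = pyrEdge-intro n sV (not d) p k (chainEdge-intro n sV (not d) p k p<k on-p
        (trans (onChain-side n sV (not d) k inner-k Vk) (==-refl (not d))) none)
      T-lacks : pyrEdge n sT p k ≡ true ⊎ PathEdge n p k → ⊥
      T-lacks (inj₁ T-has) with pyrEdge-elim n sT p k T-has
      ... | c , T-c with chainEdge-elim n sT c p k p<k T-c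
      ... | _ , on-k , none-T = true≢false (begin
        true               ≡⟨ on-k ⟨
        onChain n sT c k   ≡⟨ onChain-side n sT c k inner-k Tk ⟩
        c == d             ≡⟨ onChain-side n sT c k′ inner-k′ refl ⟨
        onChain n sT c k′  ≡⟨ none-T k′ p<k′ ≤-refl ⟩
        false              ∎)
        where open ≡-Reasoning
      T-lacks (inj₂ (inj₁ k≡1+p))   = <-irrefl (sym (suc-injective k≡1+p)) p<k′
      T-lacks (inj₂ (inj₂ (_ , e))) = <-irrefl e k<n-1

    T-switches-alone⇒constant : sT k ≡ not d → sV k ≡ d → ConstantInside n sV
    T-switches-alone⇒constant Tk Vk with lastBefore (onChain n sT (not d)) refl k z<s
    ... | p , p<k , on-p , none
        with firstAfter (onChain n sV (not d)) p N (<-trans p<k (≤-pred k<n-1))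
               (onChain-last n sV (not d) N refl)
    ... | u , p<u , u≤N , on-u , none-V = conclude (within p u p<u (s≤s u≤N) V-has)
      where
      same-below : ∀ m → m < k → onChain n sV (not d) m ≡ onChain n sT (not d) m
      same-below zero    _   = refl
      same-below (suc m) m<k = trans (onChain-side n sV (not d) (suc m) inner (agree (suc m) (s≤s z≤n) m<k))
                                     (sym (onChain-side n sT (not d) (suc m) inner refl))
        where
        inner : Inner n (suc m)
        inner = s≤s z≤n , <-trans (s≤s m<k) k<n-1
      off-k : onChain n sV (not d) k ≡ false
      off-k = trans (onChain-side n sV (not d) k inner-k Vk) (==-not d)
      p<k′ : p < k′
      p<k′ = ≤∧≢⇒< (≤-pred p<k) λ { refl → true≢false
               (trans (sym on-p) (trans (onChain-side n sT (not d) k′ inner-k′ refl) (==-not d))) }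
      k<u : k < u
      k<u with <-cmp k u
      ... | tri< k<u _ _  = k<u
      ... | tri≈ _ refl _ = ⊥-elim (true≢false (trans (sym on-u) off-k))
      ... | tri> _ _ u<k  = ⊥-elim (true≢false (trans (sym on-u) (trans (same-below u u<k) (none u p<u u<k))))
      V-has : pyrEdge n sV p u ≡ true
      V-has = pyrEdge-intro n sV (not d) p u
        (chainEdge-intro n sV (not d) p u p<u (trans (same-below p p<k) on-p) on-u none-V)
      T-lacks : ∀ c → NoneBetween (onChain n sT c) p u → ⊥
      T-lacks c none-T with ==-either c d
      ... | inj₁ c==d  = true≢false (trans (sym c==d)
              (trans (sym (onChain-side n sT c k′ inner-k′ refl)) (none-T k′ p<k′ (<-trans ≤-refl k<u))))
      ... | inj₂ c==¬d = true≢false (trans (sym c==¬d)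
              (trans (sym (onChain-side n sT c k inner-k Tk)) (none-T k (<-trans p<k′ ≤-refl) k<u)))
      conclude : pyrEdge n sT p u ≡ true ⊎ PathEdge n p u → ConstantInside n sV
      conclude (inj₁ T-has) with pyrEdge-elim n sT p u T-has
      ... | c , T-c = ⊥-elim (T-lacks c (proj₂ (proj₂ (chainEdge-elim n sT c p u p<u T-c))))
      conclude (inj₂ (inj₁ u≡1+p)) = ⊥-elim (<-irrefl (sym u≡1+p) (<-trans (s≤s p<k′) k<u))
      conclude (inj₂ (inj₂ (refl , 1+u≡n))) = d , λ m (1≤m , m<n-1) →
        not-==-false⁻ d (sV m) (trans (sym (onChain-inner n sV (not d) m (1≤m , m<n-1)))
          (none-V m 1≤m (≤-pred (subst (suc m <_) (sym 1+u≡n) m<n-1))))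

    step : ConstantInside n sV ⊎ sV k ≡ sT k
    step with sV k ≟ᵇ sT k | sT k ≟ᵇ d
    ... | yes same | _       = inj₂ same
    ... | no  V≢T  | yes Tk  = ⊥-elim (¬V-switches-alone Tk (trans (¬-not V≢T) (cong not Tk)))
    ... | no  V≢T  | no  T≢d = inj₁ (T-switches-alone⇒constant (¬-not T≢d)
                                     (trans (¬-not V≢T) (trans (cong not (¬-not T≢d)) (not-involutive d))))

  agreeBelow : sV 1 ≡ sT 1 → ∀ j → suc (suc j) < n → ConstantInside n sV ⊎ AgreeBelow (suc (suc j))
  agreeBelow V1≡T1 zero _ = inj₂ λ { (suc zero) _ _ → V1≡T1 ; (suc (suc _)) _ (s≤s (s≤s ())) }
  agreeBelow V1≡T1 (suc j) j+3<n with agreeBelow V1≡T1 j (<-trans ≤-refl j+3<n)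
  ... | inj₁ const = inj₁ const
  ... | inj₂ agree with step (suc j) (s≤s z≤n) j+3<n agree
  ...   | inj₁ const = inj₁ const
  ...   | inj₂ same  = inj₂ λ m 1≤m m<j+3 → [ agree m 1≤m , (λ { refl → same }) ]′ (m<1+n⇒m<n∨m≡n m<j+3)

  agreeInside : 2 ≤ N → sV 1 ≡ sT 1 → ConstantInside n sV ⊎ AgreeInside n sV sT
  agreeInside (s≤s (s≤s {n = j} _)) V1≡T1 =
    map₂ (λ agree k (1≤k , k<N) → agree k 1≤k (≤-pred k<N)) (agreeBelow V1≡T1 j ≤-refl)

edgesWithin⇒constant⊎same : ∀ N → 2 ≤ N → ∀ sV sT → EdgesWithin (suc N) sV sT →
  ConstantInside (suc N) sV ⊎ AgreeInside (suc N) sV sT ⊎ AgreeInside (suc N) (not ∘ sV) sT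
edgesWithin⇒constant⊎same N 2≤N sV sT within with sV 1 ≟ᵇ sT 1
... | yes V1≡T1 = map₂ inj₁ (Agreement.agreeInside N sV sT within 2≤N V1≡T1)
... | no  V1≢T1 = [ inj₁ ∘ unflip , inj₂ ∘ inj₂ ]′
                    (Agreement.agreeInside N (not ∘ sV) sT within′ 2≤N (sym (¬-not (V1≢T1 ∘ sym))))
  where
  within′ : EdgesWithin (suc N) (not ∘ sV) sT
  within′ i j i<j j<n e = within i j i<j j<n (trans (sym (pyrEdge-not (suc N) sV i j)) e)
  unflip : ConstantInside (suc N) (not ∘ sV) → ConstantInside (suc N) sV
  unflip (b , const) = not b , λ k inner → trans (sym (not-involutive (sV k))) (cong not (const k inner))

module _ {n ℓ} {R : Rel (Fin n) ℓ} (R-trans : Transitive R) (R-asym : Asymmetric R) where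

  Gap : List (Fin n) → Fin n → Fin n → Set ℓ
  Gap L x y = ∀ m → m ∈ L → R x m → R m y → ⊥

  private
    below-rest : ∀ {a L} → Linked R (a ∷ L) → All (R a) L
    below-rest [-]     = []
    below-rest (r ∷ l) = Linked⇒All R-trans r l

    ¬below-head : ∀ {b L m} → Linked R (b ∷ L) → m ∈ b ∷ L → R m b → ⊥
    ¬below-head _ (here refl) Rbb = R-asym Rbb Rbb
    ¬below-head l (there m∈L) Rmb = R-asym Rmb (All.lookup (below-rest l) m∈L)

  ∈-consec⁻ : ∀ {L x y} → Linked R L → (x , y) ∈ consec L → x ∈ L × y ∈ L × R x y × Gap L x y
  ∈-consec⁻ {a ∷ b ∷ L} (r ∷ l) (here refl) = here refl , there (here refl) , r , gap
    where
    gap : Gap (a ∷ b ∷ L) a b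
    gap m (here refl) Raa _ = R-asym Raa Raa
    gap m (there m∈) _ Rmb  = ¬below-head l m∈ Rmb
  ∈-consec⁻ {a ∷ b ∷ L} (r ∷ l) (there xy∈) with ∈-consec⁻ l xy∈
  ... | x∈ , y∈ , Rxy , gap = there x∈ , there y∈ , Rxy , gap′
    where
    gap′ : Gap (a ∷ b ∷ L) _ _
    gap′ m (here refl) Rxa _ = R-asym Rxa (All.lookup (below-rest (r ∷ l)) x∈)
    gap′ m (there m∈)  Rxm Rmy = gap m m∈ Rxm Rmy

  ∈-consec⁺ : ∀ {L x y} → Linked R L → x ∈ L → y ∈ L → R x y → Gap L x y → (x , y) ∈ consec L
  ∈-consec⁺ {a ∷ b ∷ L} (r ∷ l) (here refl) (here refl)               Raa _   = ⊥-elim (R-asym Raa Raa)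
  ∈-consec⁺ {a ∷ b ∷ L} (r ∷ l) (here refl) (there (here refl))       _   _   = here refl
  ∈-consec⁺ {a ∷ b ∷ L} (r ∷ l) (here refl) (there (there y∈))        _   gap =
    ⊥-elim (gap b (there (here refl)) r (All.lookup (below-rest l) y∈))
  ∈-consec⁺ {a ∷ b ∷ L} (r ∷ l) (there x∈)  (here refl)               Rxa _   =
    ⊥-elim (R-asym Rxa (All.lookup (below-rest (r ∷ l)) x∈))
  ∈-consec⁺ {a ∷ b ∷ L} (r ∷ l) (there x∈)  (there y∈)                Rxy gap =
    there (∈-consec⁺ l x∈ y∈ Rxy λ m m∈ → gap m (there m∈))
  ∈-consec⁺ {a ∷ []} [-] (here refl) (here refl) Raa _ = ⊥-elim (R-asym Raa Raa)

module _ {n : ℕ} where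

  hasEdge⁻ : ∀ (es : List (Fin n × Fin n)) i j → hasEdge es i j ≡ true → (i , j) ∈ es ⊎ (j , i) ∈ es
  hasEdge⁻ ((a , b) ∷ es) i j e with ∨-true⁻ _ e
  ... | inj₂ e′ = Data.Sum.map there there (hasEdge⁻ es i j e′)
  ... | inj₁ e′ with ∨-true⁻ (does (a ≟ᶠ i) ∧ does (b ≟ᶠ j)) e′
  ...   | inj₁ e″ with ∧-true⁻ (does (a ≟ᶠ i)) e″
  ...     | a≡i , b≡j = inj₁ (here (sym (cong₂ _,_ (does-true⁻ (a ≟ᶠ i) a≡i) (does-true⁻ (b ≟ᶠ j) b≡j))))
  hasEdge⁻ ((a , b) ∷ es) i j e | inj₁ e′ | inj₂ e″ with ∧-true⁻ (does (a ≟ᶠ j)) e″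
  ...     | a≡j , b≡i = inj₂ (here (sym (cong₂ _,_ (does-true⁻ (a ≟ᶠ j) a≡j) (does-true⁻ (b ≟ᶠ i) b≡i))))

  hasEdge⁺ : ∀ {es : List (Fin n × Fin n)} {i j} → (i , j) ∈ es ⊎ (j , i) ∈ es → hasEdge es i j ≡ true
  hasEdge⁺ {(a , b) ∷ es} (inj₁ (there ij∈)) = ∨-trueʳ _ (hasEdge⁺ (inj₁ ij∈))
  hasEdge⁺ {(a , b) ∷ es} (inj₂ (there ji∈)) = ∨-trueʳ _ (hasEdge⁺ (inj₂ ji∈))
  hasEdge⁺ {(a , b) ∷ es} (inj₁ (here refl))
    rewrite dec-true (a ≟ᶠ a) refl | dec-true (b ≟ᶠ b) refl = refl
  hasEdge⁺ {(a , b) ∷ es} (inj₂ (here refl))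
    rewrite dec-true (a ≟ᶠ a) refl | dec-true (b ≟ᶠ b) refl =
      ∨-trueˡ _ (∨-trueʳ (does (a ≟ᶠ b) ∧ does (b ≟ᶠ a)) refl)

  private
    lastOf-++ : ∀ (x : Fin n) xs y ys → lastOf x (xs ++ y ∷ ys) ≡ lastOf y ys
    lastOf-++ x []       y ys = refl
    lastOf-++ x (z ∷ zs) y ys = lastOf-++ z zs y ys

    consec-++ : ∀ (x : Fin n) xs y ys →
                consec (x ∷ xs ++ y ∷ ys) ≡ consec (x ∷ xs ++ y ∷ []) ++ consec (y ∷ ys)
    consec-++ x []       y ys = refl
    consec-++ x (z ∷ zs) y ys = cong ((x , z) ∷_) (consec-++ z zs y ys)

    consec-∷ʳ : ∀ (y : Fin n) ys x → consec (y ∷ ys ++ x ∷ []) ≡ consec (y ∷ ys) ++ (lastOf y ys , x) ∷ []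
    consec-∷ʳ y []       x = refl
    consec-∷ʳ y (z ∷ zs) x = cong ((y , z) ∷_) (consec-∷ʳ z zs x)

  cycEdges-↭ : ∀ (f : Fin n) A l D →
               cycEdges (f ∷ A ++ l ∷ D) ↭ consec (f ∷ A ++ l ∷ []) ++ consec (l ∷ D ++ f ∷ [])
  cycEdges-↭ f A l D rewrite lastOf-++ f A l D | consec-++ f A l D | consec-∷ʳ l D f =
    ↭-trans (∷↭∷ʳ _ _) (↭-reflexive (++-assoc (consec (f ∷ A ++ l ∷ [])) (consec (l ∷ D)) _))

Linked-∷ʳ : ∀ {a ℓ} {A : Set a} {R : Rel A ℓ} {x xs b} →
            Linked R (x ∷ xs) → All (λ y → R y b) (x ∷ xs) → Linked R (x ∷ xs ++ b ∷ [])
Linked-∷ʳ [-]     (Rxb ∷ []) = Rxb ∷ [-]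
Linked-∷ʳ (r ∷ l) (_ ∷ Rb)   = r ∷ Linked-∷ʳ l Rb

Linked-bracket : ∀ {a ℓ} {A : Set a} {R : Rel A ℓ} {a b xs} →
                 Linked R xs → All (R a) xs → All (λ x → R x b) xs → R a b → Linked R (a ∷ xs ++ b ∷ [])
Linked-bracket {xs = []}    _ _         _  Rab = Rab ∷ [-]
Linked-bracket {xs = _ ∷ _} l (Rax ∷ _) Rb _   = Rax ∷ Linked-∷ʳ l Rb

unique-++⁻ʳ : ∀ {A : Set} (xs : List A) {ys} → Unique (xs ++ ys) → Unique ys
unique-++⁻ʳ []       u       = u
unique-++⁻ʳ (_ ∷ xs) (_ ∷ u) = unique-++⁻ʳ xs u

unique-++⇒disjoint : ∀ {A : Set} (xs : List A) {ys x y} → Unique (xs ++ ys) → x ∈ xs → y ∈ ys → x ≢ y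
unique-++⇒disjoint (_ ∷ xs) (x≢ ∷ _) (here refl) y∈ = All.lookup x≢ (∈-++⁺ʳ xs y∈)
unique-++⇒disjoint (_ ∷ xs) (_ ∷ u)  (there x∈)  y∈ = unique-++⇒disjoint xs u x∈ y∈

module _ {n : ℕ} (s : ℕ → Bool) (c : Bool) (L : List (Fin n))
         (on⁺ : ∀ {x} → x ∈ L → onChain n s c (toℕ x) ≡ true)
         (on⁻ : ∀ {x} → onChain n s c (toℕ x) ≡ true → x ∈ L) where

  GapIn : Fin n → Fin n → Set
  GapIn i j = ∀ m → m ∈ L → i Fin.< m → m Fin.< j → ⊥

  chainEdge⁻ : ∀ i j → i Fin.< j → chainEdge n s c (toℕ i) (toℕ j) ≡ true → i ∈ L × j ∈ L × GapIn i j
  chainEdge⁻ i j i<j e with chainEdge-elim n s c (toℕ i) (toℕ j) i<j e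
  ... | on-i , on-j , none =
    on⁻ on-i , on⁻ on-j , λ m m∈ i<m m<j → true≢false (trans (sym (on⁺ m∈)) (none (toℕ m) i<m m<j))

  chainEdge⁺ : ∀ i j → i Fin.< j → i ∈ L → j ∈ L → GapIn i j → chainEdge n s c (toℕ i) (toℕ j) ≡ true
  chainEdge⁺ i j i<j i∈ j∈ gap = chainEdge-intro n s c (toℕ i) (toℕ j) i<j (on⁺ i∈) (on⁺ j∈) none
    where
    none : NoneBetween (onChain n s c) (toℕ i) (toℕ j)
    none k i<k k<j with onChain n s c k in e
    ... | false = refl
    ... | true  = ⊥-elim (gap m (on⁻ (subst (λ x → onChain n s c x ≡ true) (sym m≡k) e))
                             (subst (toℕ i <_) (sym m≡k) i<k) (subst (_< toℕ j) (sym m≡k) k<j))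
      where
      k<n : k < n
      k<n = <-trans k<j (toℕ<n j)
      m : Fin n
      m = fromℕ< k<n
      m≡k : toℕ m ≡ k
      m≡k = toℕ-fromℕ< k<n

edge : ∀ {n} → PyrTour n → Fin n → Fin n → Bool
edge T = hasEdge (cycEdges (cycle T))

side : ∀ {n} → PyrTour n → ℕ → Bool
side T k = does (k ∈? map toℕ (asc T))

module _ {n : ℕ} (T : PyrTour n) where

  private
    f l : Fin n
    f = first T
    l = last T

    A D : List (Fin n)
    A = asc T
    D = desc T

    unique : Unique (cycle T)
    unique = PermutationSetoid.Unique-resp-↭ (setoid (Fin n)) (↭⇒↭ₛ (↭-sym (is-perm T))) (allFin⁺ n)

    f∉ : ∀ {x} → x ∈ A ++ l ∷ D → f ≢ x
    f∉ with unique
    ... | f≢ ∷ _ = All.lookup f≢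

    A∌ : ∀ {x y} → x ∈ A → y ∈ l ∷ D → x ≢ y
    A∌ with unique
    ... | _ ∷ u = unique-++⇒disjoint A u

    l∉D : ∀ {x} → x ∈ D → l ≢ x
    l∉D with unique
    ... | _ ∷ u with unique-++⁻ʳ A u
    ...   | l≢ ∷ _ = All.lookup l≢

    f≡0 : toℕ f ≡ 0
    f≡0 = first-is-1 T

    ≡f : ∀ {x} → toℕ x ≡ 0 → x ≡ f
    ≡f x≡0 = toℕ-injective (trans x≡0 (sym f≡0))

    ≡l : ∀ {x} → suc (toℕ x) ≡ n → x ≡ l
    ≡l x≡n = toℕ-injective (suc-injective (trans x≡n (sym (last-is-n T))))

    inner : ∀ {x} → f ≢ x → l ≢ x → Inner n (toℕ x)
    inner {x} f≢x l≢x = ≤∧≢⇒< z≤n (λ 0≡x → f≢x (sym (≡f (sym 0≡x))))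
                      , ≤∧≢⇒< (toℕ<n x) (λ x≡n → l≢x (sym (≡l x≡n)))

    inner-A : ∀ {x} → x ∈ A → Inner n (toℕ x)
    inner-A x∈ = inner (f∉ (∈-++⁺ˡ x∈)) (λ l≡x → A∌ x∈ (here refl) (sym l≡x))

    inner-D : ∀ {x} → x ∈ D → Inner n (toℕ x)
    inner-D x∈ = inner (f∉ (∈-++⁺ʳ A (there x∈))) (l∉D x∈)

    toℕ-∈ : ∀ {x} → toℕ x ∈ map toℕ A → x ∈ A
    toℕ-∈ x∈ with ∈-map⁻ toℕ x∈
    ... | a , a∈ , x≡a = subst (_∈ A) (sym (toℕ-injective x≡a)) a∈

    on-f : ∀ c → onChain n (side T) c (toℕ f) ≡ true
    on-f c rewrite f≡0 = refl

    on-l : ∀ c → onChain n (side T) c (toℕ l) ≡ true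
    on-l c = onChain-last n (side T) c (toℕ l) (last-is-n T)

  side-∈⁻ : ∀ {x} → side T (toℕ x) ≡ true → x ∈ asc T
  side-∈⁻ {x} e = toℕ-∈ (does-true⁻ (toℕ x ∈? map toℕ A) e)

  side-∈⁺ : ∀ {x} → x ∈ asc T → side T (toℕ x) ≡ true
  side-∈⁺ {x} x∈ = dec-true (toℕ x ∈? map toℕ A) (∈-map⁺ toℕ x∈)

  side-∉ : ∀ {x} → ¬ x ∈ asc T → side T (toℕ x) ≡ false
  side-∉ {x} x∉ = dec-false (toℕ x ∈? map toℕ A) (x∉ ∘ toℕ-∈)

  ascChain : List (Fin n)
  ascChain = f ∷ A ++ l ∷ []

  descChain : List (Fin n)
  descChain = l ∷ D ++ f ∷ []

  onAsc⁺ : ∀ {x} → x ∈ ascChain → onChain n (side T) true (toℕ x) ≡ true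
  onAsc⁺ (here refl) = on-f true
  onAsc⁺ {x} (there x∈) with ∈-++⁻ A x∈
  ... | inj₁ x∈A         = onChain-side n (side T) true (toℕ x) (inner-A x∈A) (side-∈⁺ x∈A)
  ... | inj₂ (here refl) = on-l true

  onAsc⁻ : ∀ {x} → onChain n (side T) true (toℕ x) ≡ true → x ∈ ascChain
  onAsc⁻ {x} e with onChain⁻ n (side T) true (toℕ x) e
  ... | inj₁ x≡0        = here (≡f x≡0)
  ... | inj₂ (inj₁ x≡n) = there (∈-++⁺ʳ A (here (≡l x≡n)))
  ... | inj₂ (inj₂ asc) = there (∈-++⁺ˡ (side-∈⁻ asc))

  onDesc⁺ : ∀ {x} → x ∈ descChain → onChain n (side T) false (toℕ x) ≡ true
  onDesc⁺ (here refl) = on-l false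
  onDesc⁺ {x} (there x∈) with ∈-++⁻ D x∈
  ... | inj₂ (here refl) = on-f false
  ... | inj₁ x∈D =
    onChain-side n (side T) false (toℕ x) (inner-D x∈D) (side-∉ λ x∈A → A∌ x∈A (there x∈D) refl)

  onDesc⁻ : ∀ {x} → onChain n (side T) false (toℕ x) ≡ true → x ∈ descChain
  onDesc⁻ {x} e with onChain⁻ n (side T) false (toℕ x) e
  ... | inj₁ x≡0         = there (∈-++⁺ʳ D (here (≡f x≡0)))
  ... | inj₂ (inj₁ x≡n)  = here (≡l x≡n)
  ... | inj₂ (inj₂ desc) with ∈-resp-↭ (↭-sym (is-perm T)) (∈-allFin x)
  ...   | here x≡f  = there (∈-++⁺ʳ D (here x≡f))
  ...   | there x∈ with ∈-++⁻ A x∈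
  ...     | inj₁ x∈A         = ⊥-elim (true≢false (trans (sym (side-∈⁺ x∈A)) desc))
  ...     | inj₂ (here x≡l)  = here x≡l
  ...     | inj₂ (there x∈D) = there (∈-++⁺ˡ x∈D)

  private
    f<l : f Fin.< l
    f<l = subst (_< toℕ l) (sym f≡0)
      (≤∧≢⇒< z≤n λ 0≡l → f∉ (∈-++⁺ʳ A (here refl)) (toℕ-injective (trans f≡0 0≡l)))

    f<inner : ∀ {x : Fin n} → Inner n (toℕ x) → f Fin.< x
    f<inner {x} (1≤x , _) = subst (_< toℕ x) (sym f≡0) 1≤x

    inner<l : ∀ {x : Fin n} → Inner n (toℕ x) → x Fin.< l
    inner<l {x} (_ , x<n-1) = ≤-pred (subst (suc (toℕ x) <_) (sym (last-is-n T)) x<n-1)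

    ascChain-increasing : Linked Fin._<_ ascChain
    ascChain-increasing = Linked-bracket (asc-inc T)
      (All.tabulate (λ x∈ → f<inner (inner-A x∈))) (All.tabulate (λ x∈ → inner<l (inner-A x∈))) f<l

    descChain-decreasing : Linked (λ a b → b Fin.< a) descChain
    descChain-decreasing = Linked-bracket (desc-dec T)
      (All.tabulate (λ x∈ → inner<l (inner-D x∈))) (All.tabulate (λ x∈ → f<inner (inner-D x∈))) f<l

    >-trans : Transitive (λ (a b : Fin n) → b Fin.< a)
    >-trans a>b b>c = <-trans b>c a>b

    consec-split : ∀ {e} → e ∈ cycEdges (cycle T) → e ∈ consec ascChain ⊎ e ∈ consec descChain
    consec-split e∈ = ∈-++⁻ (consec ascChain) (∈-resp-↭ (cycEdges-↭ f A l D) e∈)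

    consec-unsplit : ∀ {e} → e ∈ consec ascChain ⊎ e ∈ consec descChain → e ∈ cycEdges (cycle T)
    consec-unsplit = ∈-resp-↭ (↭-sym (cycEdges-↭ f A l D)) ∘ [ ∈-++⁺ˡ , ∈-++⁺ʳ (consec ascChain) ]′

  edge≡pyrEdge : ∀ i j → i Fin.< j → edge T i j ≡ pyrEdge n (side T) (toℕ i) (toℕ j)
  edge≡pyrEdge i j i<j = bool-ext to from
    where
    to : edge T i j ≡ true → pyrEdge n (side T) (toℕ i) (toℕ j) ≡ true
    to e with hasEdge⁻ _ i j e
    ... | inj₁ ij∈ with consec-split ij∈
    ...   | inj₁ ∈asc with ∈-consec⁻ <-trans <-asym ascChain-increasing ∈asc
    ...     | i∈ , j∈ , _ , gap = pyrEdge-intro n (side T) true (toℕ i) (toℕ j)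
                (chainEdge⁺ (side T) true ascChain onAsc⁺ onAsc⁻ i j i<j i∈ j∈ gap)
    to e | inj₁ ij∈ | inj₂ ∈desc with ∈-consec⁻ >-trans <-asym descChain-decreasing ∈desc
    ...     | _ , _ , j<i , _ = ⊥-elim (<-asym i<j j<i)
    to e | inj₂ ji∈ with consec-split ji∈
    ...   | inj₁ ∈asc with ∈-consec⁻ <-trans <-asym ascChain-increasing ∈asc
    ...     | _ , _ , j<i , _ = ⊥-elim (<-asym i<j j<i)
    to e | inj₂ ji∈ | inj₂ ∈desc with ∈-consec⁻ >-trans <-asym descChain-decreasing ∈desc
    ...     | j∈ , i∈ , _ , gap = pyrEdge-intro n (side T) false (toℕ i) (toℕ j)
                (chainEdge⁺ (side T) false descChain onDesc⁺ onDesc⁻ i j i<j i∈ j∈ λ m m∈ i<m m<j → gap m m∈ m<j i<m)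

    from : pyrEdge n (side T) (toℕ i) (toℕ j) ≡ true → edge T i j ≡ true
    from e with pyrEdge-elim n (side T) (toℕ i) (toℕ j) e
    ... | true , ce with chainEdge⁻ (side T) true ascChain onAsc⁺ onAsc⁻ i j i<j ce
    ...   | i∈ , j∈ , gap = hasEdge⁺ (inj₁ (consec-unsplit (inj₁
              (∈-consec⁺ <-trans <-asym ascChain-increasing i∈ j∈ i<j gap))))
    from e | false , ce with chainEdge⁻ (side T) false descChain onDesc⁺ onDesc⁻ i j i<j ce
    ...   | i∈ , j∈ , gap = hasEdge⁺ (inj₂ (consec-unsplit (inj₂
              (∈-consec⁺ >-trans <-asym descChain-decreasing j∈ i∈ i<j λ m m∈ m<j i<m → gap m m∈ i<m m<j))))

AllPairs-reverse : ∀ {a ℓ} {A : Set a} {R : Rel A ℓ} {xs} →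
                   AllPairs R xs → AllPairs (λ x y → R y x) (reverse xs)
AllPairs-reverse         []         = []
AllPairs-reverse {xs = x ∷ xs} (Rx ∷ p) rewrite unfold-reverse x xs =
  AllPairs.++⁺ (AllPairs-reverse p) ([] ∷ []) (All.tabulate λ y∈ → All.lookup Rx (Any.reverse⁻ y∈) ∷ [])

filter-++-filter-∁ : ∀ {a p} {A : Set a} {P : Pred A p} (P? : Decidable P) xs →
                     filter P? xs ++ filter (∁? P?) xs ↭ xs
filter-++-filter-∁ {A = A} P? xs = ↭-sym (subst (λ yz → xs ↭ proj₁ yz ++ proj₂ yz) (partition-defn P? xs)
  (↭ₛ⇒↭ (PermutationSetoid.partition-↭ (setoid A) P? xs)))

tabulate-∷ʳ : ∀ {a} {A : Set a} m (f : Fin (suc m) → A) →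
              tabulate f ≡ tabulate (f ∘ inject₁) ++ f (fromℕ m) ∷ []
tabulate-∷ʳ zero    f = refl
tabulate-∷ʳ (suc m) f = cong (f Fin.zero ∷_) (tabulate-∷ʳ m (f ∘ Fin.suc))

module _ (m : ℕ) (s : ℕ → Bool) where

  private
    ascending? : Decidable (λ (x : Fin (suc (suc m))) → s (toℕ x) ≡ true)
    ascending? x = s (toℕ x) ≟ᵇ true

    inner : List (Fin (suc (suc m)))
    inner = tabulate (Fin.suc ∘ inject₁)

    inner-increasing : AllPairs Fin._<_ inner
    inner-increasing = AllPairs.tabulate⁺-< λ {i} {j} i<j →
      s≤s (subst₂ _<_ (sym (toℕ-inject₁ i)) (sym (toℕ-inject₁ j)) i<j)

    inner-complete : ∀ x → Inner (suc (suc m)) (toℕ x) → x ∈ inner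
    inner-complete (Fin.suc y) (_ , s≤s (s≤s y<m)) =
      subst (_∈ inner) (cong Fin.suc (inject₁-lower₁ y m≢y)) (∈-tabulate⁺ (lower₁ y m≢y))
      where
      m≢y : m ≢ toℕ y
      m≢y = ≢-sym (<⇒≢ y<m)

    last′ : Fin (suc (suc m))
    last′ = fromℕ (suc m)

    vertices : allFin (suc (suc m)) ≡ Fin.zero ∷ inner ++ last′ ∷ []
    vertices = cong (Fin.zero ∷_) (tabulate-∷ʳ m Fin.suc)

    ascList descList : List (Fin (suc (suc m)))
    ascList  = filter ascending? inner
    descList = filter (∁? ascending?) (reverse inner)

    arrange : ascList ++ last′ ∷ descList ↭ inner ++ last′ ∷ []
    arrange = begin
      ascList ++ last′ ∷ descList
        ↭⟨ shift last′ ascList descList ⟩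
      last′ ∷ ascList ++ descList
        ↭⟨ prep last′ (++⁺ˡ ascList (filter-↭ (∁? ascending?) (↭-reverse inner))) ⟩
      last′ ∷ ascList ++ filter (∁? ascending?) inner
        ↭⟨ prep last′ (filter-++-filter-∁ ascending? inner) ⟩
      last′ ∷ inner
        ↭⟨ ∷↭∷ʳ last′ inner ⟩
      inner ++ last′ ∷ []
        ∎
      where open PermutationReasoning

  pyrTourOf : PyrTour (suc (suc m))
  pyrTourOf = record
    { first      = Fin.zero
    ; last       = last′
    ; first-is-1 = refl
    ; last-is-n  = cong suc (toℕ-fromℕ (suc m))
    ; asc        = ascList
    ; desc       = descList
    ; asc-inc    = AllPairs⇒Linked (AllPairs.filter⁺ ascending? inner-increasing)
    ; desc-dec   = AllPairs⇒Linked (AllPairs.filter⁺ (∁? ascending?) (AllPairs-reverse inner-increasing))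
    ; is-perm    = subst (Fin.zero ∷ ascList ++ last′ ∷ descList ↭_) (sym vertices) (prep Fin.zero arrange)
    }

  side-pyrTourOf : AgreeInside (suc (suc m)) (side pyrTourOf) s
  side-pyrTourOf k inner-k@(_ , k<n-1) = subst (λ k → side pyrTourOf k ≡ s k) (toℕ-fromℕ< k<n) (bool-ext to from)
    where
    k<n : k < suc (suc m)
    k<n = <-trans (n<1+n k) k<n-1
    x : Fin (suc (suc m))
    x = fromℕ< k<n
    x∈inner : x ∈ inner
    x∈inner = inner-complete x (subst (Inner (suc (suc m))) (sym (toℕ-fromℕ< k<n)) inner-k)
    to : side pyrTourOf (toℕ x) ≡ true → s (toℕ x) ≡ true
    to e = proj₂ (∈-filter⁻ ascending? {xs = inner} (side-∈⁻ pyrTourOf e))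
    from : s (toℕ x) ≡ true → side pyrTourOf (toℕ x) ≡ true
    from e = side-∈⁺ pyrTourOf (∈-filter⁺ ascending? x∈inner e)

-- Linear functionals and faces of PYR(n)

module _ {A : Set} (f : A → ℚ) where

  sumℚ-nonpos : ∀ xs → (∀ x → f x ℚ.≤ 0ℚ) → sumℚ (map f xs) ℚ.≤ 0ℚ
  sumℚ-nonpos []       _  = ℚ.≤-refl
  sumℚ-nonpos (x ∷ xs) f≤0 =
    subst (f x ℚ.+ sumℚ (map f xs) ℚ.≤_) (ℚ.+-identityʳ 0ℚ) (ℚ.+-mono-≤ (f≤0 x) (sumℚ-nonpos xs f≤0))

  sumℚ-zero⁻ : ∀ xs → (∀ x → f x ℚ.≤ 0ℚ) → sumℚ (map f xs) ≡ 0ℚ → ∀ x → x ∈ xs → f x ≡ 0ℚ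
  sumℚ-zero⁻ (y ∷ xs) f≤0 sum≡0 x x∈ = zero-split x∈
    where
    f-y≥0 : 0ℚ ℚ.≤ f y
    f-y≥0 = subst₂ ℚ._≤_ sum≡0 (ℚ.+-identityʳ (f y)) (ℚ.+-monoʳ-≤ (f y) (sumℚ-nonpos xs f≤0))
    rest≥0 : 0ℚ ℚ.≤ sumℚ (map f xs)
    rest≥0 = subst₂ ℚ._≤_ sum≡0 (ℚ.+-identityˡ _) (ℚ.+-monoˡ-≤ (sumℚ (map f xs)) (f≤0 y))
    zero-split : x ∈ y ∷ xs → f x ≡ 0ℚ
    zero-split (here refl) = ℚ.≤-antisym (f≤0 y) f-y≥0
    zero-split (there x∈′) = sumℚ-zero⁻ xs f≤0 (ℚ.≤-antisym (sumℚ-nonpos xs f≤0) rest≥0) x x∈′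

  sumℚ-zero : ∀ xs → (∀ x → f x ≡ 0ℚ) → sumℚ (map f xs) ≡ 0ℚ
  sumℚ-zero []       _   = refl
  sumℚ-zero (x ∷ xs) f≡0 = trans (cong₂ ℚ._+_ (f≡0 x) (sumℚ-zero xs f≡0)) (ℚ.+-identityʳ 0ℚ)

sumℚ-+ : ∀ {A : Set} (f g : A → ℚ) xs →
         sumℚ (map f xs) ℚ.+ sumℚ (map g xs) ≡ sumℚ (map (λ x → f x ℚ.+ g x) xs)
sumℚ-+ f g []       = ℚ.+-identityʳ 0ℚ
sumℚ-+ f g (x ∷ xs) = trans (interchange (f x) _ (g x) _) (cong (f x ℚ.+ g x ℚ.+_) (sumℚ-+ f g xs))

module _ {n : ℕ} where

  private
    summand : (Fin n → Fin n → ℚ) → (Fin n → Fin n → ℚ) → Fin n → Fin n → ℚ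
    summand c x i j = if toℕ i <ᵇ toℕ j then c i j ℚ.* x i j else 0ℚ

    summand-elim : ∀ (P : ℚ → Set) c x i j → (toℕ i < toℕ j → P (c i j ℚ.* x i j)) → (¬ toℕ i < toℕ j → P 0ℚ) →
                   P (summand c x i j)
    summand-elim P c x i j P< P≮ with toℕ i <ᵇ toℕ j in e
    ... | true  = P< (<ᵇ⇒< (toℕ i) (toℕ j) (subst T (sym e) tt))
    ... | false = P≮ λ i<j → subst T e (<⇒<ᵇ i<j)

    summand-cong : ∀ c x y → (∀ i j → toℕ i < toℕ j → x i j ≡ y i j) →
                   ∀ i j → summand c x i j ≡ summand c y i j
    summand-cong c x y x≡y i j with toℕ i <ᵇ toℕ j in e
    ... | true  = cong (c i j ℚ.*_) (x≡y i j (<ᵇ⇒< (toℕ i) (toℕ j) (subst T (sym e) tt)))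
    ... | false = refl

    summand-+ : ∀ c x y i j → summand c x i j ℚ.+ summand c y i j ≡ summand c (λ i j → x i j ℚ.+ y i j) i j
    summand-+ c x y i j with toℕ i <ᵇ toℕ j
    ... | true  = sym (ℚ.*-distribˡ-+ (c i j) (x i j) (y i j))
    ... | false = ℚ.+-identityʳ 0ℚ

  module _ (c x : Fin n → Fin n → ℚ) where

    dot-nonpos : (∀ i j → toℕ i < toℕ j → c i j ℚ.* x i j ℚ.≤ 0ℚ) → dot c x ℚ.≤ 0ℚ
    dot-nonpos ≤0 = sumℚ-nonpos _ (allFin n) λ i → sumℚ-nonpos _ (allFin n) λ j →
      summand-elim (ℚ._≤ 0ℚ) c x i j (≤0 i j) (λ _ → ℚ.≤-refl)

    dot-zero⁻ : (∀ i j → toℕ i < toℕ j → c i j ℚ.* x i j ℚ.≤ 0ℚ) → dot c x ≡ 0ℚ →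
                ∀ i j → toℕ i < toℕ j → c i j ℚ.* x i j ≡ 0ℚ
    dot-zero⁻ ≤0 dot≡0 i j i<j =
      summand-elim (λ z → z ≡ 0ℚ → c i j ℚ.* x i j ≡ 0ℚ) c x i j (λ _ → id) (λ i≮j → ⊥-elim (i≮j i<j))
        (sumℚ-zero⁻ (summand c x i) (allFin n) summand≤0
          (sumℚ-zero⁻ _ (allFin n) (λ i → sumℚ-nonpos _ (allFin n) summand≤0) dot≡0 i (∈-allFin i)) j (∈-allFin j))
      where
      summand≤0 : ∀ {i} j → summand c x i j ℚ.≤ 0ℚ
      summand≤0 {i} j = summand-elim (ℚ._≤ 0ℚ) c x i j (≤0 i j) (λ _ → ℚ.≤-refl)

    dot-zero : (∀ i j → toℕ i < toℕ j → c i j ℚ.* x i j ≡ 0ℚ) → dot c x ≡ 0ℚ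
    dot-zero ≡0 = sumℚ-zero _ (allFin n) λ i → sumℚ-zero _ (allFin n) λ j →
      summand-elim (_≡ 0ℚ) c x i j (≡0 i j) (λ _ → refl)

  dot-cong : ∀ c x y → (∀ i j → toℕ i < toℕ j → x i j ≡ y i j) → dot c x ≡ dot c y
  dot-cong c x y x≡y =
    cong sumℚ (map-cong (λ i → cong sumℚ (map-cong (summand-cong c x y x≡y i) (allFin n))) (allFin n))

  dot-+ : ∀ c x y → dot c x ℚ.+ dot c y ≡ dot c (λ i j → x i j ℚ.+ y i j)
  dot-+ c x y = trans (sumℚ-+ _ _ (allFin n))
    (cong sumℚ (map-cong (λ i → trans (sumℚ-+ _ _ (allFin n)) (cong sumℚ (map-cong (summand-+ c x y i) (allFin n))))
                         (allFin n)))

𝟙 : Bool → ℚ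
𝟙 b = if b then 1ℚ else 0ℚ

𝟙-injective : ∀ a b → 𝟙 a ≡ 𝟙 b → a ≡ b
𝟙-injective true  true  _ = refl
𝟙-injective false false _ = refl

module _ {n : ℕ} where

  SameVertex-sym : {X Y : PyrTour n} → SameVertex X Y → SameVertex Y X
  SameVertex-sym X≈Y i j i<j = sym (X≈Y i j i<j)

  SameVertex-trans : {X Y Z : PyrTour n} → SameVertex X Y → SameVertex Y Z → SameVertex X Z
  SameVertex-trans X≈Y Y≈Z i j i<j = trans (X≈Y i j i<j) (Y≈Z i j i<j)

  sameVertex? : (X Y : PyrTour n) → Dec (SameVertex X Y)
  sameVertex? X Y with all? (λ i → all? (λ j → (toℕ i <? toℕ j) →-dec (χ X i j ℚ.≟ χ Y i j)))
  ... | yes all-eq = yes λ i j → all-eq i j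
  ... | no  ¬all   = no λ X≈Y → ¬all λ i j → X≈Y i j

  SameVertex⇒edge : {X Y : PyrTour n} → SameVertex X Y → ∀ i j → toℕ i < toℕ j → edge X i j ≡ edge Y i j
  SameVertex⇒edge X≈Y i j i<j = 𝟙-injective _ _ (X≈Y i j i<j)

  edge⇒SameVertex : {X Y : PyrTour n} → (∀ i j → toℕ i < toℕ j → edge X i j ≡ edge Y i j) → SameVertex X Y
  edge⇒SameVertex X≡Y i j i<j = cong 𝟙 (X≡Y i j i<j)

  EdgesIn : PyrTour n → PyrTour n → PyrTour n → Set
  EdgesIn W X Y = ∀ i j → toℕ i < toℕ j → edge W i j ≡ true → edge X i j ≡ true ⊎ edge Y i j ≡ true

  private
    cost : Bool → Bool → ℚ
    cost a b = if a ∨ b then 0ℚ else ℚ.- 1ℚ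

    cost-nonpos : ∀ a b w → cost a b ℚ.* 𝟙 w ℚ.≤ 0ℚ
    cost-nonpos true  b     w     = ℚ.≤-reflexive (ℚ.*-zeroˡ (𝟙 w))
    cost-nonpos false true  w     = ℚ.≤-reflexive (ℚ.*-zeroˡ (𝟙 w))
    cost-nonpos false false true  = toWitness {a? = ℚ.- 1ℚ ℚ.* 1ℚ ℚ.≤? 0ℚ} tt
    cost-nonpos false false false = ℚ.≤-reflexive (ℚ.*-zeroʳ (ℚ.- 1ℚ))

    cost-zeroˡ : ∀ a b → cost a b ℚ.* 𝟙 a ≡ 0ℚ
    cost-zeroˡ true  b = ℚ.*-zeroˡ 1ℚ
    cost-zeroˡ false b = ℚ.*-zeroʳ (cost false b)

    cost-zeroʳ : ∀ a b → cost a b ℚ.* 𝟙 b ≡ 0ℚ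
    cost-zeroʳ true  b     = ℚ.*-zeroˡ (𝟙 b)
    cost-zeroʳ false true  = ℚ.*-zeroˡ 1ℚ
    cost-zeroʳ false false = ℚ.*-zeroʳ (ℚ.- 1ℚ)

    cost-zero⁻ : ∀ a b → cost a b ℚ.* 𝟙 true ≡ 0ℚ → a ≡ true ⊎ b ≡ true
    cost-zero⁻ true  b    _ = inj₁ refl
    cost-zero⁻ false true _ = inj₂ refl

  -- The cost -1 on the edges outside X ∪ Y is maximised exactly by the tours with
  -- all their edges in X ∪ Y.
  edgesIn-unique⇒Adjacent : (X Y : PyrTour n) → ¬ SameVertex X Y →
                            (∀ W → EdgesIn W X Y → SameVertex W X ⊎ SameVertex W Y) → Adjacent X Y
  edgesIn-unique⇒Adjacent X Y X≉Y unique = X≉Y , c , trans dot-X (sym dot-Y) , maximal , face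
    where
    c : Fin n → Fin n → ℚ
    c i j = cost (edge X i j) (edge Y i j)
    dot-X : dot c (χ X) ≡ 0ℚ
    dot-X = dot-zero c (χ X) λ i j _ → cost-zeroˡ (edge X i j) (edge Y i j)
    dot-Y : dot c (χ Y) ≡ 0ℚ
    dot-Y = dot-zero c (χ Y) λ i j _ → cost-zeroʳ (edge X i j) (edge Y i j)
    nonpos : ∀ W i j → toℕ i < toℕ j → c i j ℚ.* χ W i j ℚ.≤ 0ℚ
    nonpos W i j _ = cost-nonpos (edge X i j) (edge Y i j) (edge W i j)
    maximal : ∀ W → dot c (χ W) ℚ.≤ dot c (χ X)
    maximal W = subst (dot c (χ W) ℚ.≤_) (sym dot-X) (dot-nonpos c (χ W) (nonpos W))
    face : ∀ W → dot c (χ W) ≡ dot c (χ X) → SameVertex W X ⊎ SameVertex W Y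
    face W dot-W = unique W λ i j i<j W-ij → cost-zero⁻ (edge X i j) (edge Y i j)
      (subst (λ w → c i j ℚ.* 𝟙 w ≡ 0ℚ) W-ij (dot-zero⁻ c (χ W) (nonpos W) (trans dot-W dot-X) i j i<j))

  -- A cost maximised at T and U has the same total at V and V′, so it is maximised at V too.
  midpoint⇒¬Adjacent : (T U V V′ : PyrTour n) →
                       (∀ i j → toℕ i < toℕ j → χ V i j ℚ.+ χ V′ i j ≡ χ T i j ℚ.+ χ U i j) →
                       ¬ SameVertex V T → ¬ SameVertex V U → ¬ Adjacent T U
  midpoint⇒¬Adjacent T U V V′ mid V≉T V≉U (_ , c , T≡U , maximal , face) =
    [ V≉T , V≉U ]′ (face V (ℚ.≤-antisym (maximal V) (ℚ.≮⇒≥ V<T⇒⊥)))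
    where
    sums : dot c (χ V) ℚ.+ dot c (χ V′) ≡ dot c (χ T) ℚ.+ dot c (χ T)
    sums = begin
      dot c (χ V) ℚ.+ dot c (χ V′)                 ≡⟨ dot-+ c (χ V) (χ V′) ⟩
      dot c (λ i j → χ V i j ℚ.+ χ V′ i j)         ≡⟨ dot-cong c _ _ mid ⟩
      dot c (λ i j → χ T i j ℚ.+ χ U i j)          ≡⟨ dot-+ c (χ T) (χ U) ⟨
      dot c (χ T) ℚ.+ dot c (χ U)                  ≡⟨ cong (dot c (χ T) ℚ.+_) T≡U ⟨
      dot c (χ T) ℚ.+ dot c (χ T)                  ∎
      where open ≡-Reasoning
    V<T⇒⊥ : dot c (χ V) ℚ.< dot c (χ T) → ⊥
    V<T⇒⊥ V<T = ℚ.<-irrefl sums (ℚ.+-mono-<-≤ V<T (maximal V′))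

-- Upper bound

module _ {n : ℕ} where

  pyrEdge⇒SameVertex : {X Y : PyrTour n} →
                       (∀ i j → i < j → j < n → pyrEdge n (side X) i j ≡ pyrEdge n (side Y) i j) → SameVertex X Y
  pyrEdge⇒SameVertex {X} {Y} X≡Y = edge⇒SameVertex {X = X} {Y = Y} λ i j i<j →
    trans (edge≡pyrEdge X i j i<j) (trans (X≡Y (toℕ i) (toℕ j) i<j (toℕ<n j)) (sym (edge≡pyrEdge Y i j i<j)))

  EdgesIn⇒pyrEdge : {W X Y : PyrTour n} → EdgesIn W X Y → ∀ i j → i < j → j < n → pyrEdge n (side W) i j ≡ true →
                    pyrEdge n (side X) i j ≡ true ⊎ pyrEdge n (side Y) i j ≡ true
  EdgesIn⇒pyrEdge {W} {X} {Y} W⊆X∪Y i j i<j j<n W-ij = Data.Sum.map (trans (sym (at X))) (trans (sym (at Y)))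
    (W⊆X∪Y (fromℕ< i<n) (fromℕ< j<n) i<j′ (trans (at W) W-ij))
    where
    i<n : i < n
    i<n = <-trans i<j j<n
    i<j′ : toℕ (fromℕ< i<n) < toℕ (fromℕ< j<n)
    i<j′ = subst₂ _<_ (sym (toℕ-fromℕ< i<n)) (sym (toℕ-fromℕ< j<n)) i<j
    at : ∀ T → edge T (fromℕ< i<n) (fromℕ< j<n) ≡ pyrEdge n (side T) i j
    at T = trans (edge≡pyrEdge T _ _ i<j′) (cong₂ (pyrEdge n (side T)) (toℕ-fromℕ< i<n) (toℕ-fromℕ< j<n))

onChain-ascending : ∀ n k → onChain n (λ _ → true) true k ≡ true
onChain-ascending n k rewrite ∨-zeroʳ (does (suc k ≟ n)) = ∨-zeroʳ (does (k ≟ 0))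

pyrEdge-ascending⇒PathEdge : ∀ n i j → i < j → j < n → pyrEdge n (λ _ → true) i j ≡ true → PathEdge n i j
pyrEdge-ascending⇒PathEdge n i j i<j j<n e with pyrEdge-elim n (λ _ → true) i j e
... | true , ce with m≤n⇒m<n∨m≡n i<j
...   | inj₂ 1+i≡j = inj₁ (sym 1+i≡j)
...   | inj₁ 1+i<j = ⊥-elim (true≢false (trans (sym (onChain-ascending n (suc i)))
                       (proj₂ (proj₂ (chainEdge-elim n _ true i j i<j ce)) (suc i) ≤-refl 1+i<j)))
pyrEdge-ascending⇒PathEdge n i j i<j j<n e | false , ce with chainEdge-elim n _ false i j i<j ce
... | on-i , on-j , _ with onChain⁻ n _ false i on-i | onChain⁻ n _ false j on-j
...   | inj₁ i≡0 | inj₂ (inj₁ 1+j≡n) = inj₂ (i≡0 , 1+j≡n)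
...   | inj₁ _   | inj₁ refl          = ⊥-elim (<⇒≱ i<j z≤n)
...   | inj₂ (inj₁ refl) | _          = ⊥-elim (<⇒≱ i<j (≤-pred j<n))

pyrEdge-constant : ∀ n b i j → pyrEdge n (λ _ → b) i j ≡ pyrEdge n (λ _ → true) i j
pyrEdge-constant n true  i j = refl
pyrEdge-constant n false i j = pyrEdge-not n (λ _ → true) i j

pathTour : ∀ m → PyrTour (suc (suc m))
pathTour m = pyrTourOf m (λ _ → true)

module _ (m : ℕ) (1≤m : 1 ≤ m) where

  private
    n : ℕ
    n = suc (suc m)
    H : PyrTour n
    H = pathTour m

  edgesIn-path : ∀ W Y → EdgesIn W H Y → SameVertex W H ⊎ SameVertex W Y
  edgesIn-path W Y W⊆H∪Y = conclude (edgesWithin⇒constant⊎same (suc m) (s≤s 1≤m) (side W) (side Y) within)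
    where
    H-ascending : AgreeInside n (side H) (λ _ → true)
    H-ascending = side-pyrTourOf m (λ _ → true)

    within : EdgesWithin n (side W) (side Y)
    within i j i<j j<n W-ij =
      [ inj₂ ∘ path-edge , inj₁ ]′ (EdgesIn⇒pyrEdge {W = W} {H} {Y} W⊆H∪Y i j i<j j<n W-ij)
      where
      path-edge : pyrEdge n (side H) i j ≡ true → PathEdge n i j
      path-edge H-ij =
        pyrEdge-ascending⇒PathEdge n i j i<j j<n (trans (sym (pyrEdge-cong n i j i<j j<n H-ascending)) H-ij)

    conclude : ConstantInside n (side W) ⊎ AgreeInside n (side W) (side Y) ⊎ AgreeInside n (not ∘ side W) (side Y) →
               SameVertex W H ⊎ SameVertex W Y
    conclude (inj₁ (b , W-constant)) = inj₁ (pyrEdge⇒SameVertex {X = W} {H} λ i j i<j j<n →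
      trans (pyrEdge-cong n i j i<j j<n W-constant)
        (trans (pyrEdge-constant n b i j) (sym (pyrEdge-cong n i j i<j j<n H-ascending))))
    conclude (inj₂ (inj₁ W≈Y)) =
      inj₂ (pyrEdge⇒SameVertex {X = W} {Y} λ i j i<j j<n → pyrEdge-cong n i j i<j j<n W≈Y)
    conclude (inj₂ (inj₂ W≈¬Y)) = inj₂ (pyrEdge⇒SameVertex {X = W} {Y} λ i j i<j j<n →
      trans (sym (pyrEdge-not n (side W) i j)) (pyrEdge-cong n i j i<j j<n W≈¬Y))

  edgesIn-pathˡ : ∀ X Y → SameVertex X H → ∀ W → EdgesIn W X Y → SameVertex W X ⊎ SameVertex W Y
  edgesIn-pathˡ X Y X≈H W W⊆X∪Y =
    map₁ (λ W≈H → SameVertex-trans {X = W} {H} {X} W≈H (SameVertex-sym {X = X} {H} X≈H))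
      (edgesIn-path W Y λ i j i<j W-ij →
         map₁ (trans (sym (SameVertex⇒edge {X = X} {H} X≈H i j i<j))) (W⊆X∪Y i j i<j W-ij))

  edgesIn-pathʳ : ∀ X Y → SameVertex Y H → ∀ W → EdgesIn W X Y → SameVertex W X ⊎ SameVertex W Y
  edgesIn-pathʳ X Y Y≈H W W⊆X∪Y =
    Data.Sum.swap (edgesIn-pathˡ Y X Y≈H W λ i j i<j → Data.Sum.swap ∘ W⊆X∪Y i j i<j)

  distance≤2 : ∀ T U → Dist≤2 T U
  distance≤2 T U with sameVertex? T U | sameVertex? T H | sameVertex? U H
  ... | yes T≈U | _       | _       = inj₁ T≈U
  ... | no  T≉U | yes T≈H | _       = inj₂ (inj₁ (edgesIn-unique⇒Adjacent T U T≉U (edgesIn-pathˡ T U T≈H)))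
  ... | no  T≉U | no  _   | yes U≈H = inj₂ (inj₁ (edgesIn-unique⇒Adjacent T U T≉U (edgesIn-pathʳ T U U≈H)))
  ... | no  _   | no  T≉H | no  U≉H = inj₂ (inj₂ (H ,
        edgesIn-unique⇒Adjacent T H T≉H (edgesIn-pathʳ T H λ _ _ _ → refl) ,
        edgesIn-unique⇒Adjacent H U (U≉H ∘ SameVertex-sym {X = H} {U}) (edgesIn-pathˡ H U λ _ _ _ → refl)))

-- Lower bound

module AscendingFrom4 (m : ℕ) (s : ℕ → Bool) (ascending : ∀ k → s (4 + k) ≡ true) where

  private
    n : ℕ
    n = 6 + m

    s≥4 : ∀ k → 4 ≤ k → s k ≡ true
    s≥4 k 4≤k = subst (λ x → s x ≡ true) (m+[n∸m]≡n 4≤k) (ascending (k ∸ 4))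

    on-asc : ∀ k → 4 ≤ k → k < n → onChain n s true k ≡ true
    on-asc k 4≤k k<n with m≤n⇒m<n∨m≡n k<n
    ... | inj₁ k<n-1 = onChain-side n s true k (≤-trans (s≤s z≤n) 4≤k , k<n-1) (s≥4 k 4≤k)
    ... | inj₂ last  = onChain-last n s true k last

    off-desc : ∀ k → 4 ≤ k → suc k < n → onChain n s false k ≡ false
    off-desc k 4≤k k<n-1 = onChain-side n s false k (≤-trans (s≤s z≤n) 4≤k , k<n-1) (s≥4 k 4≤k)

    4<n-1 : 4 < 5 + m
    4<n-1 = s≤s (s≤s (s≤s (s≤s (s≤s z≤n))))

    4<n : 4 < n
    4<n = <-trans 4<n-1 ≤-refl

  pyrEdge-next : ∀ i → 4 ≤ i → suc i < n → pyrEdge n s i (suc i) ≡ true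
  pyrEdge-next i 4≤i i<n-1 = pyrEdge-intro n s true i (suc i)
    (chainEdge-intro n s true i (suc i) ≤-refl (on-asc i 4≤i (<-trans (n<1+n i) i<n-1))
      (on-asc (suc i) (≤-trans 4≤i (n≤1+n i)) i<n-1) (noneBetween-suc _ i))

  pyrEdge-far : ∀ i j → 4 ≤ i → suc i < j → j < n → pyrEdge n s i j ≡ false
  pyrEdge-far i j 4≤i i+1<j j<n = cong₂ _∨_
    (chainEdge-blocked n s true i j (suc i) ≤-refl i+1<j
       (on-asc (suc i) (≤-trans 4≤i (n≤1+n i)) (<-trans i+1<j j<n)))
    (chainEdge-offˡ n s false i j (off-desc i 4≤i (<-trans i+1<j j<n)))

  pyrEdge-skip : ∀ i j → i ≤ 3 → 5 ≤ j → suc j < n → pyrEdge n s i j ≡ false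
  pyrEdge-skip i j i≤3 5≤j j<n-1 = cong₂ _∨_
    (chainEdge-blocked n s true i j 4 (s≤s i≤3) 5≤j (on-asc 4 ≤-refl 4<n))
    (chainEdge-offʳ n s false i j (off-desc j (≤-trans (n≤1+n 4) 5≤j) j<n-1))

  -- Only the descending chain reaches the last vertex n-1 from i ≤ 3, and it jumps there from below 4.
  pyrEdge-last : ∀ i → i ≤ 3 →
                 pyrEdge n s i (5 + m) ≡ onChain n s false i ∧ noneFrom (onChain n s false) (suc i) (3 ∸ i)
  pyrEdge-last i i≤3 = begin
    pyrEdge n s i (5 + m)
      ≡⟨ cong (_∨ chainEdge n s false i (5 + m))
              (chainEdge-blocked n s true i (5 + m) 4 (s≤s i≤3) 4<n-1 (on-asc 4 ≤-refl 4<n)) ⟩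
    onChain n s false i ∧ onChain n s false (5 + m) ∧ noneFrom (onChain n s false) (suc i) ((3 + suc m) ∸ i)
      ≡⟨ cong (λ b → onChain n s false i ∧ b ∧ noneFrom (onChain n s false) (suc i) ((3 + suc m) ∸ i))
              (onChain-last n s false (5 + m) refl) ⟩
    onChain n s false i ∧ true ∧ noneFrom (onChain n s false) (suc i) ((3 + suc m) ∸ i)
      ≡⟨ cong (λ l → onChain n s false i ∧ noneFrom (onChain n s false) (suc i) l) (+-∸-comm (suc m) i≤3) ⟩
    onChain n s false i ∧ noneFrom (onChain n s false) (suc i) ((3 ∸ i) + suc m)
      ≡⟨ cong (onChain n s false i ∧_) (noneFrom-extend _ (suc i) (3 ∸ i) (suc m) λ k 4≤k k<n-1 →
           off-desc k (subst (_≤ k) (m+[n∸m]≡n {suc i} {4} (s≤s i≤3)) 4≤k)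
                      (s≤s (subst (λ x → k < x + suc m) (m+[n∸m]≡n {suc i} {4} (s≤s i≤3)) k<n-1))) ⟩
    onChain n s false i ∧ noneFrom (onChain n s false) (suc i) (3 ∸ i)
      ∎
    where open ≡-Reasoning

sides : Bool → Bool → Bool → ℕ → Bool
sides a b c 1 = a
sides a b c 2 = b
sides a b c 3 = c
sides a b c _ = true

-- The tours V, V′, T, U of the lower bound, given by their sides on 1, 2, 3.
Balanced : (Bool → Bool → Bool → Bool) → Set
Balanced e =
  𝟙 (e false false true) ℚ.+ 𝟙 (e false true false) ≡ 𝟙 (e true true false) ℚ.+ 𝟙 (e true false true)

Balanced-resp : ∀ {e e′} → (∀ a b c → e a b c ≡ e′ a b c) → Balanced e′ → Balanced e
Balanced-resp e≡e′ balanced =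
  trans (cong₂ ℚ._+_ (cong 𝟙 (e≡e′ false false true)) (cong 𝟙 (e≡e′ false true false)))
    (trans balanced (sym (cong₂ ℚ._+_ (cong 𝟙 (e≡e′ true true false)) (cong 𝟙 (e≡e′ true false true)))))

module _ (m : ℕ) where

  private
    n : ℕ
    n = 6 + m

    module Far (a b c : Bool) = AscendingFrom4 m (sides a b c) (λ _ → refl)

    uniform : ∀ i j v → (∀ a b c → pyrEdge n (sides a b c) i j ≡ v) →
              Balanced (λ a b c → pyrEdge n (sides a b c) i j)
    uniform i j v all≡v = Balanced-resp all≡v refl

    near : ∀ i j → i < j → j ≤ 4 → Balanced (λ a b c → pyrEdge n (sides a b c) i j)
    near 0 1 _ _ = refl
    near 0 2 _ _ = refl
    near 0 3 _ _ = refl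
    near 0 4 _ _ = refl
    near 1 2 _ _ = refl
    near 1 3 _ _ = refl
    near 1 4 _ _ = refl
    near 2 3 _ _ = refl
    near 2 4 _ _ = refl
    near 3 4 _ _ = refl
    near _ 0 () _
    near (suc _) 1 (s≤s ()) _
    near (suc (suc _)) 2 (s≤s (s≤s ())) _
    near (suc (suc (suc _))) 3 (s≤s (s≤s (s≤s ()))) _
    near (suc (suc (suc (suc _)))) 4 (s≤s (s≤s (s≤s (s≤s ())))) _
    near _ (suc (suc (suc (suc (suc _))))) _ (s≤s (s≤s (s≤s (s≤s ()))))

    to-last : ∀ i → i ≤ 3 → Balanced (λ a b c → pyrEdge n (sides a b c) i (5 + m))
    to-last i i≤3 = Balanced-resp (λ a b c → Far.pyrEdge-last a b c i i≤3) (values i i≤3)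
      where
      values : ∀ i → i ≤ 3 → Balanced λ a b c →
                 onChain n (sides a b c) false i ∧ noneFrom (onChain n (sides a b c) false) (suc i) (3 ∸ i)
      values 0 _ = refl
      values 1 _ = refl
      values 2 _ = refl
      values 3 _ = refl
      values (suc (suc (suc (suc _)))) (s≤s (s≤s (s≤s ())))

  balanced : ∀ i j → i < j → j < n → Balanced (λ a b c → pyrEdge n (sides a b c) i j)
  balanced i j i<j j<n with 4 ≤? i | m≤n⇒m<n∨m≡n i<j
  ... | yes 4≤i | inj₂ refl    = uniform i j true λ a b c → Far.pyrEdge-next a b c i 4≤i j<n
  ... | yes 4≤i | inj₁ i+1<j   = uniform i j false λ a b c → Far.pyrEdge-far a b c i j 4≤i i+1<j j<n
  ... | no  i≱4 | _ with 5 ≤? j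
  ...   | no  j≱5 = near i j i<j (≤-pred (≰⇒> j≱5))
  ...   | yes 5≤j with m≤n⇒m<n∨m≡n j<n
  ...     | inj₁ j<n-1 = uniform i j false λ a b c → Far.pyrEdge-skip a b c i j (≤-pred (≰⇒> i≱4)) 5≤j j<n-1
  ...     | inj₂ refl  = to-last i (≤-pred (≰⇒> i≱4))

  tour : Bool → Bool → Bool → PyrTour n
  tour a b c = pyrTourOf (4 + m) (sides a b c)

  private
    edge-tour : ∀ a b c (i j : Fin n) → toℕ i < toℕ j →
                edge (tour a b c) i j ≡ pyrEdge n (sides a b c) (toℕ i) (toℕ j)
    edge-tour a b c i j i<j = trans (edge≡pyrEdge (tour a b c) i j i<j)
      (pyrEdge-cong n (toℕ i) (toℕ j) i<j (toℕ<n j) (side-pyrTourOf (4 + m) (sides a b c)))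

    distinct : ∀ a b c a′ b′ c′ (i j : Fin n) (i<j : toℕ i < toℕ j) →
               pyrEdge n (sides a b c) (toℕ i) (toℕ j) ≡ true → pyrEdge n (sides a′ b′ c′) (toℕ i) (toℕ j) ≡ false →
               ¬ SameVertex (tour a b c) (tour a′ b′ c′)
    distinct a b c a′ b′ c′ i j i<j e e′ same = true≢false (begin
      true                                       ≡⟨ e ⟨
      pyrEdge n (sides a b c) (toℕ i) (toℕ j)    ≡⟨ edge-tour a b c i j i<j ⟨
      edge (tour a b c) i j                      ≡⟨ SameVertex⇒edge {X = tour a b c} {tour a′ b′ c′} same i j i<j ⟩
      edge (tour a′ b′ c′) i j                   ≡⟨ edge-tour a′ b′ c′ i j i<j ⟩
      pyrEdge n (sides a′ b′ c′) (toℕ i) (toℕ j) ≡⟨ e′ ⟩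
      false                                      ∎)
      where open ≡-Reasoning

  tours-distinct : ¬ SameVertex (tour true true false) (tour true false true)
  tours-distinct = distinct true true false true false true (# 1) (# 2) (s≤s (s≤s z≤n)) refl refl

  tours-nonadjacent : ¬ Adjacent (tour true true false) (tour true false true)
  tours-nonadjacent =
    midpoint⇒¬Adjacent (tour true true false) (tour true false true) (tour false false true) (tour false true false)
    (λ i j i<j → Balanced-resp (λ a b c → edge-tour a b c i j i<j) (balanced (toℕ i) (toℕ j) i<j (toℕ<n j)))
    (distinct false false true true true false (# 3) (# 4) (s≤s (s≤s (s≤s (s≤s z≤n)))) refl refl)
    (distinct false false true true false true (# 1) (# 2) (s≤s (s≤s z≤n)) refl refl)

theorem5 : (n : ℕ) → 6 ≤ n → Diameter≡2 n
theorem5 _ (s≤s (s≤s (s≤s (s≤s (s≤s (s≤s {n = m} _)))))) =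
  distance≤2 (4 + m) (s≤s z≤n) ,
  tour m true true false , tour m true false true , tours-distinct m , tours-nonadjacent m
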